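{- There is a constant $c > 0$ such that for every positive integer $n$, every simplicial complex $X$ with fundamental group isomorphic to $\mathbb{Z}^n$ has at least $c\, n^{2/3}$ vertices.
   Context: Simplicial complexes are finite and connected, so the fundamental group does not depend on the basepoint. -}

module Defs where

open import Data.Nat using (ℕ; suc; _*_; _^_; _≤_; _<_)
open import Data.Integer using (ℤ) renaming (_+_ to _+ℤ_)
open import Data.Vec using (Vec; zipWith)
open import Data.Bool using (Bool; T)
open import Data.Fin using (Fin)
open import Data.Fin.Subset using (Subset; ⁅_⁆; _∪_; _⊆_)
open import Data.Product using (Σ; ∃; _×_)
open import Relation.Binary.PropositionalEquality using (_≡_)

record SimplicialComplex (m : ℕ) : Set where
  field
    face        : Subset m → Bool
    down-closed : ∀ {s t : Subset m} → s ⊆ t → T (face t) → T (face s)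
    vertex      : ∀ (v : Fin m) → T (face ⁅ v ⁆)

module _ {m : ℕ} (X : SimplicialComplex m) where
  open SimplicialComplex X

  Adj : Fin m → Fin m → Set
  Adj u v = T (face (⁅ u ⁆ ∪ ⁅ v ⁆))

  Tri : Fin m → Fin m → Fin m → Set
  Tri u v w = T (face (⁅ u ⁆ ∪ ⁅ v ⁆ ∪ ⁅ w ⁆))

  data Walk : Fin m → Fin m → Set where
    []  : ∀ {v} → Walk v v
    _∷_ : ∀ {u v w} → Adj u v → Walk v w → Walk u w

  infixr 5 _∷_ _++_
  _++_ : ∀ {u v w} → Walk u v → Walk v w → Walk u w
  [] ++ q = q
  (e ∷ p) ++ q = e ∷ (p ++ q)

  -- edge-path equivalence (Spanier): the congruence generated by
  --   (u,u) ~ empty   and   (u,v)(v,w) ~ (u,w)  when {u,v,w} is a simplex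
  data _~_ : ∀ {u w} → Walk u w → Walk u w → Set where
    ~-refl  : ∀ {u w} {p : Walk u w} → p ~ p
    ~-sym   : ∀ {u w} {p q : Walk u w} → p ~ q → q ~ p
    ~-trans : ∀ {u w} {p q r : Walk u w} → p ~ q → q ~ r → p ~ r
    ~-cons  : ∀ {u v w} (e : Adj u v) {p q : Walk v w} → p ~ q → (e ∷ p) ~ (e ∷ q)
    ~-stat  : ∀ {u w} (e : Adj u u) (p : Walk u w) → (e ∷ p) ~ p
    ~-tri   : ∀ {u v w x} → Tri u v w → (e₁ : Adj u v) (e₂ : Adj v w) (e₃ : Adj u w)
              (p : Walk w x) → (e₁ ∷ e₂ ∷ p) ~ (e₃ ∷ p)

  Connected : Set
  Connected = ∀ (u v : Fin m) → Walk u v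

  -- The edge-path group π₁(X, b) (loops at b modulo _~_, product _++_)
  -- is isomorphic to ℤⁿ: a homomorphism on loops respecting _~_ which
  -- induces a bijection of the quotient onto ℤⁿ.
  record π₁≅ℤ^ (b : Fin m) (n : ℕ) : Set where
    field
      to      : Walk b b → Vec ℤ n
      to-cong : ∀ {p q : Walk b b} → p ~ q → to p ≡ to q
      to-hom  : ∀ (p q : Walk b b) → to (p ++ q) ≡ zipWith _+ℤ_ (to p) (to q)
      to-inj  : ∀ {p q : Walk b b} → to p ≡ to q → p ~ q
      to-surj : ∀ (z : Vec ℤ n) → Σ (Walk b b) (λ p → to p ≡ z)

-- Work over 𝔽₂. The isomorphism π₁(X) ≅ ℤⁿ yields mod-2 cocycles χ₁ … χₙ on edge paths and pairwise
-- commuting loops L₁ … Lₙ with χᵢ(Lⱼ) = δᵢⱼ. Split the indices into two blocks of size a = ⌊n/2⌋; each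
-- a × a matrix S over 𝔽₂ gives the pairing ⟪p , q⟫ = Σ S_kl χ_k(p) χ_{a+l}(q) of edge paths. Suppose two
-- such pairings agree on the edge pairs (uv, vw) of all 2-simplices {u,v,w}, so that their difference
-- ⟪_,_⟫ vanishes there. Then A(e₁ ⋯ e_r) = Σᵢ ⟪eᵢ , eᵢ₊₁ ⋯ e_r⟫ is invariant under edge-path equivalence
-- and A(pq) = A(p) + A(q) + ⟪p , q⟫, so ⟪_,_⟫ is symmetric on commuting loops; evaluated on L_k and
-- L_{a+l} this says that the two matrices agree. Hence the 2^(a²) matrices inject into the 𝔽₂-valued
-- functions on triples of vertices, a² ≤ m³, and n ≤ 2a + 1 gives n² ≤ 9 m³.
{-# OPTIONS --safe #-}
module Submission where

open import Defs hiding (_++_; _~_)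
import Defs
open import Data.Nat
  using (ℕ; zero; suc; _+_; _*_; _^_; _≤_; _<_; z≤n; s≤s; ⌊_/2⌋; ⌈_/2⌉; parity; >-nonZero⁻¹)
open import Data.Nat.Properties
  using (≤-trans; ≤-reflexive; +-suc; +-monoʳ-≤; +-monoˡ-≤; *-monoʳ-≤; ^-monoˡ-≤; ^-monoʳ-<; m≤n*m;
         ≮⇒≥; <⇒≱; ⌊n/2⌋+⌈n/2⌉≡n; ⌊n/2⌋≤⌈n/2⌉; ⌊n/2⌋-mono; n≤1+n; module ≤-Reasoning)
open import Data.Nat.Solver using (module +-*-Solver)
open import Data.Integer using (ℤ; +_; -[1+_]; _⊖_; 0ℤ; 1ℤ)
import Data.Integer as ℤ
import Data.Integer.Properties as ℤ
open import Data.Fin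
  using (Fin; zero; suc; inject≤; _↑ˡ_; _↑ʳ_; splitAt; funToFin; finToFun; combine; remQuot)
open import Data.Fin.Properties
  using (_≟_; nonZeroIndex; inject≤-injective; ↑ˡ-injective; ↑ʳ-injective; splitAt-↑ˡ; splitAt-↑ʳ; injective⇒≤;
         finToFun-funToFin; funToFin-finToFin; remQuot-combine; combine-remQuot)
open import Data.Fin.Subset using (Subset; ⁅_⁆; _∪_; _⊆_)
open import Data.Fin.Subset.Properties using (⊆-trans; p⊆p∪q; q⊆p∪q; x∈p∪q⁻)
open import Data.Vec using (Vec; lookup; tabulate; zipWith)
open import Data.Vec.Properties using (lookup-zipWith; lookup∘tabulate; zipWith-comm)
open import Data.Bool using (if_then_else_)
open import Data.Bool.Properties using (T?; T-irrelevant; if-float)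
open import Data.Parity.Base using (Parity; 0ℙ; 1ℙ) renaming (_+_ to _⊕_; _*_ to _·_)
open import Data.Parity.Properties
  using (+-homo-+; +-assoc; +-comm; +-identityʳ; +-cancelˡ-≡; +-cancelʳ-≡; p+p≡0ℙ;
         *-identityʳ; *-zeroʳ; *-assoc; *-distribˡ-+; *-distribʳ-+; +-0-commutativeMonoid; +-*-semiring)
import Algebra.Solver.CommutativeMonoid as CommutativeMonoidSolver
open import Algebra.Properties.Semiring.Sum +-*-semiring
  using (sum-syntax; sum-cong-≗; ∑-distrib-+; sum-replicate-zero)
open import Data.Product using (Σ; _×_; _,_; proj₁; proj₂; uncurry)
open import Data.Sum using (inj₁; inj₂; [_,_])
open import Data.Empty using (⊥-elim)
open import Function using (_∘_)
open import Relation.Nullary using (yes; no; does)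
open import Relation.Nullary.Decidable using (dec-true; dec-false)
open import Relation.Binary.Bundles using (Setoid)
import Relation.Binary.Reasoning.Setoid as SetoidReasoning
open import Relation.Binary.PropositionalEquality hiding ([_])

parity-suc-suc : ∀ m n → parity (suc m) ⊕ parity (suc n) ≡ parity m ⊕ parity n
parity-suc-suc m n = begin
  parity (suc m) ⊕ parity (suc n) ≡⟨ +-homo-+ (suc m) (suc n) ⟨
  parity (suc m + suc n)          ≡⟨ cong (parity ∘ suc) (+-suc m n) ⟩
  parity (m + n)                  ≡⟨ +-homo-+ m n ⟩
  parity m ⊕ parity n             ∎
  where open ≡-Reasoning

parityℤ : ℤ → Parity
parityℤ (+ n)    = parity n
parityℤ -[1+ n ] = parity (suc n)

parityℤ-⊖ : ∀ m n → parityℤ (m ⊖ n) ≡ parity m ⊕ parity n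
parityℤ-⊖ m       zero    = sym (+-identityʳ (parity m))
parityℤ-⊖ zero    (suc n) = refl
parityℤ-⊖ (suc m) (suc n) =
  trans (cong parityℤ (ℤ.[1+m]⊖[1+n]≡m⊖n m n)) (trans (parityℤ-⊖ m n) (sym (parity-suc-suc m n)))

parityℤ-+ : ∀ x y → parityℤ (x ℤ.+ y) ≡ parityℤ x ⊕ parityℤ y
parityℤ-+ (+ m)    (+ n)    = +-homo-+ m n
parityℤ-+ (+ m)    -[1+ n ] = parityℤ-⊖ m (suc n)
parityℤ-+ -[1+ m ] (+ n)    = trans (parityℤ-⊖ n (suc m)) (+-comm (parity n) (parity (suc m)))
parityℤ-+ -[1+ m ] -[1+ n ] = trans (+-homo-+ m n) (sym (parity-suc-suc m n))

x≡x⊕x⇒x≡0ℙ : ∀ {x} → x ≡ x ⊕ x → x ≡ 0ℙ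
x≡x⊕x⇒x≡0ℙ {x} x≡x⊕x = trans x≡x⊕x (p+p≡0ℙ x)

δ : ∀ {a} → Fin a → Fin a → Parity
δ i j = if does (i ≟ j) then 1ℙ else 0ℙ

δ-≢ : ∀ {a} {i j : Fin a} → i ≢ j → δ i j ≡ 0ℙ
δ-≢ {i = i} {j} i≢j = cong (if_then 1ℙ else 0ℙ) (dec-false (i ≟ j) i≢j)

δ-refl : ∀ {a} (i : Fin a) → δ i i ≡ 1ℙ
δ-refl i = cong (if_then 1ℙ else 0ℙ) (dec-true (i ≟ i) refl)

δ-injective : ∀ {a b} (f : Fin a → Fin b) → (∀ {i j} → f i ≡ f j → i ≡ j) → ∀ i j → δ (f i) (f j) ≡ δ i j
δ-injective f f-injective i j with i ≟ j
... | yes refl = δ-refl (f i)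
... | no i≢j   = δ-≢ (i≢j ∘ f-injective)

∑-zero : ∀ {a} (f : Fin a → Parity) → (∀ k → f k ≡ 0ℙ) → ∑[ k < a ] f k ≡ 0ℙ
∑-zero {a} f f≗0 = trans (sum-cong-≗ f≗0) (sum-replicate-zero a)

∑-δ : ∀ {a} (f : Fin a → Parity) (j : Fin a) → ∑[ k < a ] (f k · δ k j) ≡ f j
∑-δ {suc a} f zero = begin
  (f zero · 1ℙ) ⊕ ∑[ k < a ] (f (suc k) · 0ℙ)
    ≡⟨ cong₂ _⊕_ (*-identityʳ (f zero)) (∑-zero _ (*-zeroʳ ∘ f ∘ suc)) ⟩
  f zero ⊕ 0ℙ
    ≡⟨ +-identityʳ (f zero) ⟩
  f zero ∎
  where open ≡-Reasoning
∑-δ {suc a} f (suc j) =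
  trans (cong (_⊕ ∑[ k < a ] (f (suc k) · δ k j)) (*-zeroʳ (f zero))) (∑-δ (f ∘ suc) j)

Matrix : ℕ → Set
Matrix a = Fin a → Fin a → Parity

Table : ℕ → Set
Table m = Fin m → Fin m → Fin m → Parity

∑∑-⊕ : ∀ {a} (f g h : Matrix a) → (∀ k l → f k l ≡ g k l ⊕ h k l) →
       ∑[ k < a ] ∑[ l < a ] f k l ≡ ∑[ k < a ] ∑[ l < a ] g k l ⊕ ∑[ k < a ] ∑[ l < a ] h k l
∑∑-⊕ {a} f g h f≡g⊕h =
  trans (sum-cong-≗ (λ k → trans (sum-cong-≗ (f≡g⊕h k)) (∑-distrib-+ (g k) (h k))))
        (∑-distrib-+ (λ k → ∑[ l < a ] g k l) (λ k → ∑[ l < a ] h k l))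

2^-cancel-≤ : ∀ {p q} → 2 ^ p ≤ 2 ^ q → p ≤ q
2^-cancel-≤ 2^p≤2^q = ≮⇒≥ λ q<p → <⇒≱ (^-monoʳ-< 2 (s≤s (s≤s z≤n)) q<p) 2^p≤2^q

funToFin-cong : ∀ {p q} {f g : Fin p → Fin q} → f ≗ g → funToFin f ≡ funToFin g
funToFin-cong {zero}  f≗g = refl
funToFin-cong {suc p} f≗g = cong₂ combine (f≗g zero) (funToFin-cong (f≗g ∘ suc))

toFin : Parity → Fin 2
toFin 0ℙ = zero
toFin 1ℙ = suc zero

fromFin : Fin 2 → Parity
fromFin zero       = 0ℙ
fromFin (suc zero) = 1ℙ

fromFin-toFin : ∀ x → fromFin (toFin x) ≡ x
fromFin-toFin 0ℙ = refl
fromFin-toFin 1ℙ = refl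

toFin-fromFin : ∀ i → toFin (fromFin i) ≡ i
toFin-fromFin zero       = refl
toFin-fromFin (suc zero) = refl

toFin-injective : ∀ {x y} → toFin x ≡ toFin y → x ≡ y
toFin-injective {x} {y} eq = trans (sym (fromFin-toFin x)) (trans (cong fromFin eq) (fromFin-toFin y))

parityFun-injective⇒≤ : ∀ {p q} (Φ : (Fin p → Parity) → (Fin q → Parity)) →
         (∀ {f g} → Φ f ≗ Φ g → f ≗ g) → p ≤ q
parityFun-injective⇒≤ {p} {q} Φ Φ-injective =
  2^-cancel-≤ (injective⇒≤ {f = encode ∘ Φ ∘ decode} (decode-injective ∘ Φ-injective ∘ encode-injective))
  where
  encode : (Fin q → Parity) → Fin (2 ^ q)
  encode f = funToFin (toFin ∘ f)

  decode : Fin (2 ^ p) → (Fin p → Parity)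
  decode i = fromFin ∘ finToFun i

  encode-injective : ∀ {f g} → encode f ≡ encode g → f ≗ g
  encode-injective {f} {g} eq k = toFin-injective (begin
    toFin (f k)           ≡⟨ finToFun-funToFin (toFin ∘ f) k ⟨
    finToFun (encode f) k ≡⟨ cong (λ i → finToFun i k) eq ⟩
    finToFun (encode g) k ≡⟨ finToFun-funToFin (toFin ∘ g) k ⟩
    toFin (g k)           ∎)
    where open ≡-Reasoning

  decode-injective : ∀ {i j} → decode i ≗ decode j → i ≡ j
  decode-injective {i} {j} eq = begin
    i                             ≡⟨ funToFin-finToFin {p} {2} i ⟨
    funToFin (finToFun {2} {p} i) ≡⟨ funToFin-cong (λ k → trans (sym (toFin-fromFin _))
                                       (trans (cong toFin (eq k)) (toFin-fromFin _))) ⟩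
    funToFin (finToFun {2} {p} j) ≡⟨ funToFin-finToFin {p} {2} j ⟩
    j                             ∎
    where open ≡-Reasoning

module _ {A : Set} {p q : ℕ} where

  curry₂ : (Fin (p * q) → A) → Fin p → Fin q → A
  curry₂ f k l = f (combine k l)

  uncurry₂ : (Fin p → Fin q → A) → Fin (p * q) → A
  uncurry₂ g = uncurry g ∘ remQuot {p} q

  uncurry₂-combine : ∀ g k l → uncurry₂ g (combine k l) ≡ g k l
  uncurry₂-combine g k l = cong (uncurry g) (remQuot-combine k l)

  curry₂-injective : ∀ {f g} → (∀ k l → curry₂ f k l ≡ curry₂ g k l) → f ≗ g
  curry₂-injective {f} {g} f≗g i = begin
    f i                                   ≡⟨ cong f (combine-remQuot {p} q i) ⟨
    f (uncurry combine (remQuot {p} q i)) ≡⟨ uncurry f≗g (remQuot {p} q i) ⟩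
    g (uncurry combine (remQuot {p} q i)) ≡⟨ cong g (combine-remQuot {p} q i) ⟩
    g i                                   ∎
    where open ≡-Reasoning

square≤cube : ∀ {a m} (Φ : Matrix a → Table m) →
              (∀ {S S′} → (∀ u v w → Φ S u v w ≡ Φ S′ u v w) → ∀ k l → S k l ≡ S′ k l) →
              a * a ≤ m * (m * m)
square≤cube {a} {m} Φ Φ-injective = parityFun-injective⇒≤ flatΦ flatΦ-injective
  where
  flatΦ : (Fin (a * a) → Parity) → (Fin (m * (m * m)) → Parity)
  flatΦ f = uncurry₂ λ u → uncurry₂ (Φ (curry₂ f) u)

  flatΦ-combine : ∀ f u v w → flatΦ f (combine u (combine v w)) ≡ Φ (curry₂ f) u v w
  flatΦ-combine f u v w = trans (uncurry₂-combine (λ u → uncurry₂ (Φ (curry₂ f) u)) u (combine v w))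
                                (uncurry₂-combine (Φ (curry₂ f) u) v w)

  flatΦ-injective : ∀ {f g} → flatΦ f ≗ flatΦ g → f ≗ g
  flatΦ-injective {f} {g} eq = curry₂-injective (Φ-injective λ u v w →
    trans (sym (flatΦ-combine f u v w)) (trans (eq (combine u (combine v w))) (flatΦ-combine g u v w)))

∪-lub : ∀ {n} {p q r : Subset n} → p ⊆ r → q ⊆ r → p ∪ q ⊆ r
∪-lub {p = p} {q} p⊆r q⊆r x∈p∪q = [ p⊆r , q⊆r ] (x∈p∪q⁻ p q x∈p∪q)

module _ {m : ℕ} (X : SimplicialComplex m) where
  open SimplicialComplex X

  private variable
    u v w x y : Fin m

  infixr 5 _++_
  _++_ : Walk X u v → Walk X v w → Walk X u w
  _++_ = Defs._++_ X

  infix 4 _~_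
  _~_ : Walk X u w → Walk X u w → Set
  _~_ = Defs._~_ X

  ++-assoc : (p : Walk X u v) (q : Walk X v w) (r : Walk X w x) → (p ++ q) ++ r ≡ p ++ q ++ r
  ++-assoc []      q r = refl
  ++-assoc (e ∷ p) q r = cong (e ∷_) (++-assoc p q r)

  ++-identityʳ : (p : Walk X u v) → p ++ [] ≡ p
  ++-identityʳ []      = refl
  ++-identityʳ (e ∷ p) = cong (e ∷_) (++-identityʳ p)

  ++-congˡ : (r : Walk X u v) {p q : Walk X v w} → p ~ q → r ++ p ~ r ++ q
  ++-congˡ []      p~q = p~q
  ++-congˡ (e ∷ r) p~q = ~-cons e (++-congˡ r p~q)

  ++-congʳ : {p q : Walk X u v} → p ~ q → (r : Walk X v w) → p ++ r ~ q ++ r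
  ++-congʳ ~-refl               r = ~-refl
  ++-congʳ (~-sym p~q)          r = ~-sym (++-congʳ p~q r)
  ++-congʳ (~-trans p~q q~s)    r = ~-trans (++-congʳ p~q r) (++-congʳ q~s r)
  ++-congʳ (~-cons e p~q)       r = ~-cons e (++-congʳ p~q r)
  ++-congʳ (~-stat e p)         r = ~-stat e (p ++ r)
  ++-congʳ (~-tri t e₁ e₂ e₃ p) r = ~-tri t e₁ e₂ e₃ (p ++ r)

  ~-setoid : Fin m → Fin m → Setoid _ _
  ~-setoid u w = record
    { Carrier       = Walk X u w
    ; _≈_           = _~_
    ; isEquivalence = record { refl = ~-refl ; sym = ~-sym ; trans = ~-trans }
    }

  Adj-sym : Adj X u v → Adj X v u
  Adj-sym = down-closed (∪-lub (q⊆p∪q _ _) (p⊆p∪q _))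

  Tri-edge₁₂ : Tri X u v w → Adj X u v
  Tri-edge₁₂ = down-closed (∪-lub (p⊆p∪q _) (⊆-trans (p⊆p∪q _) (q⊆p∪q _ _)))

  Tri-edge₂₃ : Tri X u v w → Adj X v w
  Tri-edge₂₃ = down-closed (q⊆p∪q _ _)

  backtrack : (e : Adj X u v) (e′ : Adj X v u) (p : Walk X u w) → e ∷ e′ ∷ p ~ p
  backtrack e e′ p = ~-trans (~-tri uvu e e′ uu p) (~-stat uu p)
    where
    uvu = down-closed (∪-lub (p⊆p∪q _) (∪-lub (q⊆p∪q _ _) (p⊆p∪q _))) e
    uu  = down-closed (∪-lub (p⊆p∪q _) (p⊆p∪q _)) e

  reverse : Walk X u v → Walk X v u
  reverse []      = []
  reverse (e ∷ p) = reverse p ++ Adj-sym e ∷ []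

  reverse-cancelˡ : (p : Walk X u v) (r : Walk X v w) → reverse p ++ p ++ r ~ r
  reverse-cancelˡ []      r = ~-refl
  reverse-cancelˡ (e ∷ p) r = begin
    (reverse p ++ e′ ∷ []) ++ e ∷ p ++ r ≡⟨ ++-assoc (reverse p) (e′ ∷ []) (e ∷ p ++ r) ⟩
    reverse p ++ e′ ∷ e ∷ p ++ r         ≈⟨ ++-congˡ (reverse p) (backtrack e′ e (p ++ r)) ⟩
    reverse p ++ p ++ r                  ≈⟨ reverse-cancelˡ p r ⟩
    r                                    ∎
    where
    open SetoidReasoning (~-setoid _ _)
    e′ = Adj-sym e

  reverse-cancelʳ : (p : Walk X u v) (r : Walk X u w) → p ++ reverse p ++ r ~ r
  reverse-cancelʳ []      r = ~-refl
  reverse-cancelʳ (e ∷ p) r = begin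
    e ∷ p ++ (reverse p ++ e′ ∷ []) ++ r ≡⟨ cong (λ s → e ∷ p ++ s) (++-assoc (reverse p) (e′ ∷ []) r) ⟩
    e ∷ p ++ reverse p ++ e′ ∷ r         ≈⟨ ~-cons e (reverse-cancelʳ p (e′ ∷ r)) ⟩
    e ∷ e′ ∷ r                           ≈⟨ backtrack e e′ r ⟩
    r                                    ∎
    where
    open SetoidReasoning (~-setoid _ _)
    e′ = Adj-sym e

  record Cocycle : Set where
    field
      _⟦_⟧    : Walk X u v → Parity
      ⟦⟧-cong : {p q : Walk X u v} → p ~ q → _⟦_⟧ p ≡ _⟦_⟧ q
      ⟦⟧-++   : (p : Walk X u v) (q : Walk X v w) → _⟦_⟧ (p ++ q) ≡ _⟦_⟧ p ⊕ _⟦_⟧ q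

  open Cocycle

  module CupSymmetry
    (⟪_,_⟫    : ∀ {u v w x} → Walk X u v → Walk X w x → Parity)
    (⟪⟫-congˡ : ∀ {u v w x} {p p′ : Walk X u v} (q : Walk X w x) → p ~ p′ → ⟪ p , q ⟫ ≡ ⟪ p′ , q ⟫)
    (⟪⟫-congʳ : ∀ {u v w x} (p : Walk X u v) {q q′ : Walk X w x} → q ~ q′ → ⟪ p , q ⟫ ≡ ⟪ p , q′ ⟫)
    (⟪⟫-++ˡ   : ∀ {u v w x y} (p : Walk X u v) (p′ : Walk X v w) (q : Walk X x y) →
                ⟪ p ++ p′ , q ⟫ ≡ ⟪ p , q ⟫ ⊕ ⟪ p′ , q ⟫)
    (⟪⟫-++ʳ   : ∀ {u v w x y} (p : Walk X u v) (q : Walk X w x) (q′ : Walk X x y) →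
                ⟪ p , q ++ q′ ⟫ ≡ ⟪ p , q ⟫ ⊕ ⟪ p , q′ ⟫)
    (⟪⟫-Tri   : ∀ {u v w} → Tri X u v w → (e₁ : Adj X u v) (e₂ : Adj X v w) → ⟪ e₁ ∷ [] , e₂ ∷ [] ⟫ ≡ 0ℙ)
    where

    ⟪[]⟫ : (q : Walk X w x) → ⟪ [] {v = u} , q ⟫ ≡ 0ℙ
    ⟪[]⟫ q = x≡x⊕x⇒x≡0ℙ (⟪⟫-++ˡ [] [] q)

    potential : Walk X u v → Parity
    potential []      = 0ℙ
    potential (e ∷ p) = ⟪ e ∷ [] , p ⟫ ⊕ potential p

    potential-cong : {p q : Walk X u v} → p ~ q → potential p ≡ potential q
    potential-cong ~-refl               = refl
    potential-cong (~-sym p~q)          = sym (potential-cong p~q)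
    potential-cong (~-trans p~q q~r)    = trans (potential-cong p~q) (potential-cong q~r)
    potential-cong (~-cons e p~q)       = cong₂ _⊕_ (⟪⟫-congʳ (e ∷ []) p~q) (potential-cong p~q)
    potential-cong (~-stat e p)         =
      cong (_⊕ potential p) (trans (⟪⟫-congˡ p (~-stat e [])) (⟪[]⟫ p))
    potential-cong (~-tri t e₁ e₂ e₃ p) = begin
      ⟪ e₁ ∷ [] , e₂ ∷ p ⟫ ⊕ (⟪ e₂ ∷ [] , p ⟫ ⊕ potential p)
        ≡⟨ cong (_⊕ (⟪ e₂ ∷ [] , p ⟫ ⊕ potential p)) (trans (⟪⟫-++ʳ (e₁ ∷ []) (e₂ ∷ []) p)
             (cong (_⊕ ⟪ e₁ ∷ [] , p ⟫) (⟪⟫-Tri t e₁ e₂))) ⟩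
      ⟪ e₁ ∷ [] , p ⟫ ⊕ (⟪ e₂ ∷ [] , p ⟫ ⊕ potential p)
        ≡⟨ +-assoc ⟪ e₁ ∷ [] , p ⟫ ⟪ e₂ ∷ [] , p ⟫ (potential p) ⟨
      (⟪ e₁ ∷ [] , p ⟫ ⊕ ⟪ e₂ ∷ [] , p ⟫) ⊕ potential p
        ≡⟨ cong (_⊕ potential p) (trans (sym (⟪⟫-++ˡ (e₁ ∷ []) (e₂ ∷ []) p))
             (⟪⟫-congˡ p (~-tri t e₁ e₂ e₃ []))) ⟩
      ⟪ e₃ ∷ [] , p ⟫ ⊕ potential p ∎
      where open ≡-Reasoning

    potential-++ : (p : Walk X u v) (q : Walk X v w) →
                   potential (p ++ q) ≡ (potential p ⊕ potential q) ⊕ ⟪ p , q ⟫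
    potential-++ []      q = sym (trans (cong (potential q ⊕_) (⟪[]⟫ q)) (+-identityʳ (potential q)))
    potential-++ (e ∷ p) q = begin
      ⟪ e ∷ [] , p ++ q ⟫ ⊕ potential (p ++ q)
        ≡⟨ cong₂ _⊕_ (⟪⟫-++ʳ (e ∷ []) p q) (potential-++ p q) ⟩
      (⟪ e ∷ [] , p ⟫ ⊕ ⟪ e ∷ [] , q ⟫) ⊕ ((potential p ⊕ potential q) ⊕ ⟪ p , q ⟫)
        ≡⟨ solve 5 (λ a b c d f → (a ⊞ b) ⊞ ((c ⊞ d) ⊞ f) ⊜ ((a ⊞ c) ⊞ d) ⊞ (b ⊞ f)) refl
             ⟪ e ∷ [] , p ⟫ ⟪ e ∷ [] , q ⟫ (potential p) (potential q) ⟪ p , q ⟫ ⟩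
      ((⟪ e ∷ [] , p ⟫ ⊕ potential p) ⊕ potential q) ⊕ (⟪ e ∷ [] , q ⟫ ⊕ ⟪ p , q ⟫)
        ≡⟨ cong (((⟪ e ∷ [] , p ⟫ ⊕ potential p) ⊕ potential q) ⊕_) (⟪⟫-++ˡ (e ∷ []) p q) ⟨
      (potential (e ∷ p) ⊕ potential q) ⊕ ⟪ e ∷ p , q ⟫ ∎
      where
      open ≡-Reasoning
      open CommutativeMonoidSolver +-0-commutativeMonoid using (solve; _⊜_) renaming (_⊕_ to _⊞_)

    ⟪⟫-symmetric : (P Q : Walk X u u) → P ++ Q ~ Q ++ P → ⟪ P , Q ⟫ ≡ ⟪ Q , P ⟫
    ⟪⟫-symmetric P Q PQ~QP = +-cancelˡ-≡ (potential P ⊕ potential Q) _ _ (begin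
      (potential P ⊕ potential Q) ⊕ ⟪ P , Q ⟫ ≡⟨ potential-++ P Q ⟨
      potential (P ++ Q)                      ≡⟨ potential-cong PQ~QP ⟩
      potential (Q ++ P)                      ≡⟨ potential-++ Q P ⟩
      (potential Q ⊕ potential P) ⊕ ⟪ Q , P ⟫ ≡⟨ cong (_⊕ ⟪ Q , P ⟫) (+-comm (potential Q) _) ⟩
      (potential P ⊕ potential Q) ⊕ ⟪ Q , P ⟫ ∎)
      where open ≡-Reasoning

  module _ {a : ℕ} (c d : Fin a → Cocycle) where

    cup : Matrix a → Walk X u v → Walk X w x → Parity
    cup S p q = ∑[ k < a ] ∑[ l < a ] (S k l · (c k ⟦ p ⟧ · d l ⟦ q ⟧))

    cup-congˡ : ∀ S {p p′ : Walk X u v} (q : Walk X w x) → p ~ p′ → cup S p q ≡ cup S p′ q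
    cup-congˡ S q p~p′ = sum-cong-≗ λ k → sum-cong-≗ λ l →
      cong (λ z → S k l · (z · d l ⟦ q ⟧)) (⟦⟧-cong (c k) p~p′)

    cup-congʳ : ∀ S (p : Walk X u v) {q q′ : Walk X w x} → q ~ q′ → cup S p q ≡ cup S p q′
    cup-congʳ S p q~q′ = sum-cong-≗ λ k → sum-cong-≗ λ l →
      cong (λ z → S k l · (c k ⟦ p ⟧ · z)) (⟦⟧-cong (d l) q~q′)

    cup-++ˡ : ∀ S (p : Walk X u v) (p′ : Walk X v w) (q : Walk X x y) →
              cup S (p ++ p′) q ≡ cup S p q ⊕ cup S p′ q
    cup-++ˡ S p p′ q = ∑∑-⊕ _ _ _ λ k l → trans
      (cong (λ z → S k l · (z · d l ⟦ q ⟧)) (⟦⟧-++ (c k) p p′))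
      (trans (cong (S k l ·_) (*-distribʳ-+ (d l ⟦ q ⟧) (c k ⟦ p ⟧) (c k ⟦ p′ ⟧)))
             (*-distribˡ-+ (S k l) _ _))

    cup-++ʳ : ∀ S (p : Walk X u v) (q : Walk X w x) (q′ : Walk X x y) →
              cup S p (q ++ q′) ≡ cup S p q ⊕ cup S p q′
    cup-++ʳ S p q q′ = ∑∑-⊕ _ _ _ λ k l → trans
      (cong (λ z → S k l · (c k ⟦ p ⟧ · z)) (⟦⟧-++ (d l) q q′))
      (trans (cong (S k l ·_) (*-distribˡ-+ (c k ⟦ p ⟧) (d l ⟦ q ⟧) (d l ⟦ q′ ⟧)))
             (*-distribˡ-+ (S k l) _ _))

    cup-⊕ : ∀ S S′ (p : Walk X u v) (q : Walk X w x) →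
            cup (λ k l → S k l ⊕ S′ k l) p q ≡ cup S p q ⊕ cup S′ p q
    cup-⊕ S S′ p q = ∑∑-⊕ _ _ _ λ k l → *-distribʳ-+ _ (S k l) (S′ k l)

    cup-δ : ∀ S (p : Walk X u v) (q : Walk X w x) {k₀ l₀} →
            (∀ k → c k ⟦ p ⟧ ≡ δ k k₀) → (∀ l → d l ⟦ q ⟧ ≡ δ l l₀) → cup S p q ≡ S k₀ l₀
    cup-δ S p q {k₀} {l₀} c≡δ d≡δ = begin
      cup S p q
        ≡⟨ (sum-cong-≗ λ k → sum-cong-≗ λ l →
             trans (cong (S k l ·_) (cong₂ _·_ (c≡δ k) (d≡δ l))) (sym (*-assoc (S k l) _ _))) ⟩
      ∑[ k < a ] ∑[ l < a ] ((S k l · δ k k₀) · δ l l₀)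
        ≡⟨ sum-cong-≗ (λ k → ∑-δ (λ l → S k l · δ k k₀) l₀) ⟩
      ∑[ k < a ] (S k l₀ · δ k k₀)
        ≡⟨ ∑-δ (λ k → S k l₀) k₀ ⟩
      S k₀ l₀ ∎
      where open ≡-Reasoning

    cup-zeroˡ : ∀ S (p : Walk X u v) (q : Walk X w x) → (∀ k → c k ⟦ p ⟧ ≡ 0ℙ) → cup S p q ≡ 0ℙ
    cup-zeroˡ S p q c≡0 = ∑-zero _ λ k → ∑-zero _ λ l →
      trans (cong (λ z → S k l · (z · d l ⟦ q ⟧)) (c≡0 k)) (*-zeroʳ (S k l))

  triangleTable : (∀ {u v w x} → Walk X u v → Walk X w x → Parity) → Table m
  triangleTable ⟪_,_⟫ u v w with T? (face (⁅ u ⁆ ∪ ⁅ v ⁆ ∪ ⁅ w ⁆))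
  ... | yes t = ⟪ Tri-edge₁₂ t ∷ [] , Tri-edge₂₃ t ∷ [] ⟫
  ... | no _  = 0ℙ

  triangleTable-Tri : (⟪_,_⟫ : ∀ {u v w x} → Walk X u v → Walk X w x → Parity) →
                      Tri X u v w → (e₁ : Adj X u v) (e₂ : Adj X v w) →
                      triangleTable ⟪_,_⟫ u v w ≡ ⟪ e₁ ∷ [] , e₂ ∷ [] ⟫
  triangleTable-Tri {u} {v} {w} ⟪_,_⟫ t e₁ e₂ with T? (face (⁅ u ⁆ ∪ ⁅ v ⁆ ∪ ⁅ w ⁆))
  ... | yes t′ = cong₂ (λ (e : Adj X u v) (e′ : Adj X v w) → ⟪ e ∷ [] , e′ ∷ [] ⟫)
                       (T-irrelevant _ _) (T-irrelevant _ _)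
  ... | no ¬t  = ⊥-elim (¬t t)

  module _ {a : ℕ} (c d : Fin a → Cocycle) {b : Fin m} (P Q : Fin a → Walk X b b)
           (c-P : ∀ k k′ → c k ⟦ P k′ ⟧ ≡ δ k k′)
           (d-Q : ∀ l l′ → d l ⟦ Q l′ ⟧ ≡ δ l l′)
           (c-Q : ∀ k l → c k ⟦ Q l ⟧ ≡ 0ℙ)
           (P-Q-commute : ∀ k l → P k ++ Q l ~ Q l ++ P k)
           where

    cupTable : Matrix a → Table m
    cupTable S = triangleTable (cup c d S)

    cupTable-injective : ∀ {S S′} → (∀ u v w → cupTable S u v w ≡ cupTable S′ u v w) →
                         ∀ k l → S k l ≡ S′ k l
    cupTable-injective {S} {S′} same k l = +-cancelʳ-≡ (S′ k l) (S k l) (S′ k l) (begin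
      S k l ⊕ S′ k l        ≡⟨ cup-δ c d D (P k) (Q l) (λ k′ → c-P k′ k) (λ l′ → d-Q l′ l) ⟨
      cup c d D (P k) (Q l) ≡⟨ ⟪⟫-symmetric (P k) (Q l) (P-Q-commute k l) ⟩
      cup c d D (Q l) (P k) ≡⟨ cup-zeroˡ c d D (Q l) (P k) (λ k′ → c-Q k′ l) ⟩
      0ℙ                    ≡⟨ p+p≡0ℙ (S′ k l) ⟨
      S′ k l ⊕ S′ k l       ∎)
      where
      open ≡-Reasoning

      D : Matrix a
      D k l = S k l ⊕ S′ k l

      cupD-Tri : Tri X u v w → (e₁ : Adj X u v) (e₂ : Adj X v w) → cup c d D (e₁ ∷ []) (e₂ ∷ []) ≡ 0ℙ
      cupD-Tri {u} {v} {w} t e₁ e₂ = begin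
        cup c d D (e₁ ∷ []) (e₂ ∷ [])
          ≡⟨ cup-⊕ c d S S′ (e₁ ∷ []) (e₂ ∷ []) ⟩
        cup c d S (e₁ ∷ []) (e₂ ∷ []) ⊕ cup c d S′ (e₁ ∷ []) (e₂ ∷ [])
          ≡⟨ cong₂ _⊕_ (triangleTable-Tri (cup c d S) t e₁ e₂) (triangleTable-Tri (cup c d S′) t e₁ e₂) ⟨
        cupTable S u v w ⊕ cupTable S′ u v w
          ≡⟨ cong (_⊕ cupTable S′ u v w) (same u v w) ⟩
        cupTable S′ u v w ⊕ cupTable S′ u v w
          ≡⟨ p+p≡0ℙ (cupTable S′ u v w) ⟩
        0ℙ ∎

      open CupSymmetry (cup c d D) (cup-congˡ c d D) (cup-congʳ c d D) (cup-++ˡ c d D) (cup-++ʳ c d D)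
                       cupD-Tri

    dual-blocks-bound : a * a ≤ m * (m * m)
    dual-blocks-bound = square≤cube cupTable cupTable-injective

  dual-system-bound : ∀ {n} (χ : Fin n → Cocycle) {b : Fin m} (L : Fin n → Walk X b b) →
                      (∀ i j → χ i ⟦ L j ⟧ ≡ δ i j) → (∀ i j → L i ++ L j ~ L j ++ L i) →
                      ∀ a → a + a ≤ n → a * a ≤ m * (m * m)
  dual-system-bound {n} χ L χL≡δ L-commute a 2a≤n = dual-blocks-bound (χ ∘ ι) (χ ∘ ι′) (L ∘ ι) (L ∘ ι′)
    (λ k k′ → trans (χL≡δ (ι k) (ι k′)) (δ-injective ι ι-injective k k′))
    (λ l l′ → trans (χL≡δ (ι′ l) (ι′ l′)) (δ-injective ι′ ι′-injective l l′))
    (λ k l → trans (χL≡δ (ι k) (ι′ l)) (δ-≢ (ι≢ι′ k l)))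
    (λ k l → L-commute (ι k) (ι′ l))
    where
    ι ι′ : Fin a → Fin n
    ι  k = inject≤ (k ↑ˡ a) 2a≤n
    ι′ l = inject≤ (a ↑ʳ l) 2a≤n

    ι-injective : ∀ {k k′} → ι k ≡ ι k′ → k ≡ k′
    ι-injective = ↑ˡ-injective a _ _ ∘ inject≤-injective 2a≤n 2a≤n _ _

    ι′-injective : ∀ {l l′} → ι′ l ≡ ι′ l′ → l ≡ l′
    ι′-injective = ↑ʳ-injective a _ _ ∘ inject≤-injective 2a≤n 2a≤n _ _

    ι≢ι′ : ∀ k l → ι k ≢ ι′ l
    ι≢ι′ k l ιk≡ι′l = inj₁≢inj₂ (begin
      inj₁ k             ≡⟨ splitAt-↑ˡ a k a ⟨
      splitAt a (k ↑ˡ a) ≡⟨ cong (splitAt a) (inject≤-injective 2a≤n 2a≤n _ _ ιk≡ι′l) ⟩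
      splitAt a (a ↑ʳ l) ≡⟨ splitAt-↑ʳ a a l ⟩
      inj₂ l             ∎)
      where
      open ≡-Reasoning
      inj₁≢inj₂ : inj₁ k ≢ inj₂ l
      inj₁≢inj₂ ()

  module _ (conn : Connected X) {b : Fin m} {n : ℕ} (iso : π₁≅ℤ^ X b n) where
    open π₁≅ℤ^ iso

    π₁-commutative : (P Q : Walk X b b) → P ++ Q ~ Q ++ P
    π₁-commutative P Q = to-inj (begin
      to (P ++ Q)                 ≡⟨ to-hom P Q ⟩
      zipWith ℤ._+_ (to P) (to Q) ≡⟨ zipWith-comm ℤ.+-comm (to P) (to Q) ⟩
      zipWith ℤ._+_ (to Q) (to P) ≡⟨ to-hom Q P ⟨
      to (Q ++ P)                 ∎)
      where open ≡-Reasoning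

    conj : Walk X u v → Walk X b b
    conj {u} {v} p = conn b u ++ p ++ reverse (conn b v)

    conj-cong : {p q : Walk X u v} → p ~ q → conj p ~ conj q
    conj-cong {u} {v} p~q = ++-congˡ (conn b u) (++-congʳ p~q (reverse (conn b v)))

    conj-++ : (p : Walk X u v) (q : Walk X v w) → conj p ++ conj q ~ conj (p ++ q)
    conj-++ {u} {v} {w} p q = begin
      (γu ++ p ++ reverse γv) ++ γv ++ q ++ reverse γw
        ≡⟨ trans (++-assoc γu _ _) (cong (γu ++_) (++-assoc p (reverse γv) _)) ⟩
      γu ++ p ++ reverse γv ++ γv ++ q ++ reverse γw
        ≈⟨ ++-congˡ γu (++-congˡ p (reverse-cancelˡ γv (q ++ reverse γw))) ⟩
      γu ++ p ++ q ++ reverse γw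
        ≡⟨ cong (γu ++_) (++-assoc p q (reverse γw)) ⟨
      γu ++ (p ++ q) ++ reverse γw ∎
      where
      open SetoidReasoning (~-setoid b b)
      γu = conn b u
      γv = conn b v
      γw = conn b w

    conj-loop : (P : Walk X b b) → conj P ~ P
    conj-loop P = begin
      γ ++ P ++ reverse γ           ≡⟨ ++-assoc γ P (reverse γ) ⟨
      (γ ++ P) ++ reverse γ         ≈⟨ ++-congʳ (π₁-commutative γ P) (reverse γ) ⟩
      (P ++ γ) ++ reverse γ         ≡⟨ ++-assoc P γ (reverse γ) ⟩
      P ++ γ ++ reverse γ           ≡⟨ cong (λ r → P ++ γ ++ r) (++-identityʳ (reverse γ)) ⟨
      P ++ γ ++ reverse γ ++ []     ≈⟨ ++-congˡ P (reverse-cancelʳ γ []) ⟩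
      P ++ []                       ≡⟨ ++-identityʳ P ⟩
      P                             ∎
      where
      open SetoidReasoning (~-setoid b b)
      γ = conn b b

    loopParity : Fin n → Walk X b b → Parity
    loopParity i P = parityℤ (lookup (to P) i)

    loopParity-cong : ∀ i {P Q} → P ~ Q → loopParity i P ≡ loopParity i Q
    loopParity-cong i P~Q = cong (λ z → parityℤ (lookup z i)) (to-cong P~Q)

    loopParity-++ : ∀ i P Q → loopParity i (P ++ Q) ≡ loopParity i P ⊕ loopParity i Q
    loopParity-++ i P Q = begin
      parityℤ (lookup (to (P ++ Q)) i)
        ≡⟨ cong (λ z → parityℤ (lookup z i)) (to-hom P Q) ⟩
      parityℤ (lookup (zipWith ℤ._+_ (to P) (to Q)) i)
        ≡⟨ cong parityℤ (lookup-zipWith ℤ._+_ i (to P) (to Q)) ⟩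
      parityℤ (lookup (to P) i ℤ.+ lookup (to Q) i)
        ≡⟨ parityℤ-+ (lookup (to P) i) (lookup (to Q) i) ⟩
      loopParity i P ⊕ loopParity i Q ∎
      where open ≡-Reasoning

    coordinate : Fin n → Cocycle
    coordinate i = record
      { _⟦_⟧    = loopParity i ∘ conj
      ; ⟦⟧-cong = loopParity-cong i ∘ conj-cong
      ; ⟦⟧-++   = λ p q → trans (loopParity-cong i (~-sym (conj-++ p q)))
                                (loopParity-++ i (conj p) (conj q))
      }

    unitVector : Fin n → Vec ℤ n
    unitVector j = tabulate λ i → if does (i ≟ j) then 1ℤ else 0ℤ

    basisLoop : Fin n → Walk X b b
    basisLoop j = proj₁ (to-surj (unitVector j))

    coordinate-basisLoop : ∀ i j → coordinate i ⟦ basisLoop j ⟧ ≡ δ i j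
    coordinate-basisLoop i j = begin
      loopParity i (conj (basisLoop j))          ≡⟨ loopParity-cong i (conj-loop (basisLoop j)) ⟩
      parityℤ (lookup (to (basisLoop j)) i)      ≡⟨ cong (λ z → parityℤ (lookup z i)) (proj₂ (to-surj _)) ⟩
      parityℤ (lookup (unitVector j) i)          ≡⟨ cong parityℤ (lookup∘tabulate _ i) ⟩
      parityℤ (if does (i ≟ j) then 1ℤ else 0ℤ)  ≡⟨ if-float parityℤ (does (i ≟ j)) ⟩
      δ i j                                      ∎
      where open ≡-Reasoning

    π₁≅ℤⁿ-bound : ∀ a → a + a ≤ n → a * a ≤ m * (m * m)
    π₁≅ℤⁿ-bound = dual-system-bound coordinate basisLoop coordinate-basisLoop
      (λ i j → π₁-commutative (basisLoop i) (basisLoop j))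

⌊n/2⌋+⌊n/2⌋≤n : ∀ n → ⌊ n /2⌋ + ⌊ n /2⌋ ≤ n
⌊n/2⌋+⌊n/2⌋≤n n = ≤-trans (+-monoʳ-≤ ⌊ n /2⌋ (⌊n/2⌋≤⌈n/2⌉ n)) (≤-reflexive (⌊n/2⌋+⌈n/2⌉≡n n))

n≤1+⌊n/2⌋+⌊n/2⌋ : ∀ n → n ≤ suc (⌊ n /2⌋ + ⌊ n /2⌋)
n≤1+⌊n/2⌋+⌊n/2⌋ n = begin
  n                         ≡⟨ ⌊n/2⌋+⌈n/2⌉≡n n ⟨
  ⌊ n /2⌋ + ⌈ n /2⌉         ≤⟨ +-monoʳ-≤ ⌊ n /2⌋ (⌊n/2⌋-mono (n≤1+n (suc n))) ⟩
  ⌊ n /2⌋ + suc ⌊ n /2⌋     ≡⟨ +-suc ⌊ n /2⌋ ⌊ n /2⌋ ⟩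
  suc (⌊ n /2⌋ + ⌊ n /2⌋)   ∎
  where open ≤-Reasoning

n²≤9m³ : ∀ a {n m} → a * a ≤ m * (m * m) → n ≤ suc (a + a) → 1 ≤ m → n ^ 2 ≤ 9 * m ^ 3
n²≤9m³ zero {n} {m} _ n≤1 1≤m = begin
  n ^ 2     ≤⟨ ^-monoˡ-≤ 2 n≤1 ⟩
  1 ^ 3     ≤⟨ ^-monoˡ-≤ 3 1≤m ⟩
  m ^ 3     ≤⟨ m≤n*m (m ^ 3) 9 ⟩
  9 * m ^ 3 ∎
  where open ≤-Reasoning
n²≤9m³ (suc a) {n} {m} a²≤m³ n≤1+2a _ = begin
  n ^ 2                   ≤⟨ ^-monoˡ-≤ 2 (≤-trans n≤1+2a (+-monoˡ-≤ (A + A) {1} {A} (s≤s z≤n))) ⟩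
  (A + (A + A)) ^ 2       ≡⟨ solve 1 (λ x → (x :+ (x :+ x)) :^ 2 := con 9 :* (x :* x)) refl A ⟩
  9 * (A * A)             ≤⟨ *-monoʳ-≤ 9 a²≤m³ ⟩
  9 * (m * (m * m))       ≡⟨ solve 1 (λ x → con 9 :* (x :* (x :* x)) := con 9 :* (x :^ 3)) refl m ⟩
  9 * m ^ 3               ∎
  where
  open ≤-Reasoning
  open +-*-Solver
  A = suc a

proposition3p5 : Σ ℕ (λ k → 0 < k × (∀ (n : ℕ) → 1 ≤ n → ∀ (m : ℕ) (X : SimplicialComplex m)
                   → Connected X → (b : Fin m) → π₁≅ℤ^ X b n → n ^ 2 ≤ k * m ^ 3))
proposition3p5 = 9 , s≤s z≤n , λ n _ m X conn b iso →
  let a = ⌊ n /2⌋ in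
  n²≤9m³ a (π₁≅ℤⁿ-bound X conn iso a (⌊n/2⌋+⌊n/2⌋≤n n)) (n≤1+⌊n/2⌋+⌊n/2⌋ n) (>-nonZero⁻¹ m ⦃ nonZeroIndex b ⦄)
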